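{- The variety $\mathbb{BD}_2$ of Heyting algebras satisfying the equation $1\approx x_2\vee(x_2\to(x_1\vee x_1^*))$ is closed under hyper-MacNeille completions.
   Context: In a Heyting algebra, $x^*=x\to 0$ is the pseudo-complement. For a Heyting algebra $A$, let $W=A\times A$ with relation $N$ defined by $(s,a)\,N\,(t,b)$ iff $s\vee t\vee(a\to b)=1$. For $X\subseteq W$ put $U(X)=\{u\in W:\forall w\in X\,(w\,N\,u)\}$ and $L(X)=\{w\in W:\forall u\in X\,(w\,N\,u)\}$. The hyper-MacNeille completion $A^+$ is the set of $X\subseteq W$ with $X=L(U(X))$, ordered by inclusion (a complete Heyting algebra). Closure under hyper-MacNeille completions means $A\in\mathbb{BD}_2$ implies $A^+\in\mathbb{BD}_2$. -}

module Defs where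

open import Level using (Level; _⊔_; suc)
open import Data.Product using (_×_; _,_; Σ; ∃)
open import Data.Sum using (_⊎_)
open import Data.Empty.Polymorphic using (⊥)
open import Relation.Unary using (Pred; _⊆_; _∩_; _∪_)
open import Relation.Binary.Lattice.Bundles using (HeytingAlgebra)

module HyperMacNeille {c ℓ₁ ℓ₂ : Level} (A : HeytingAlgebra c ℓ₁ ℓ₂) where
  open HeytingAlgebra A renaming (⊤ to 1A; ⊥ to 0A)

  _* : Carrier → Carrier
  x * = x ⇨ 0A

  BD₂ : Set (c ⊔ ℓ₁)
  BD₂ = ∀ x₁ x₂ → 1A ≈ (x₂ ∨ (x₂ ⇨ (x₁ ∨ (x₁ *))))

  W : Set c
  W = Carrier × Carrier

  _N_ : W → W → Set ℓ₁
  (s , a) N (t , b) = (s ∨ t ∨ (a ⇨ b)) ≈ 1A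

  Sub : Set (suc (c ⊔ ℓ₁))
  Sub = Pred W (c ⊔ ℓ₁)

  U : ∀ {ℓ} → Pred W ℓ → Pred W (c ⊔ ℓ₁ ⊔ ℓ)
  U X u = ∀ w → X w → w N u

  L : ∀ {ℓ} → Pred W ℓ → Pred W (c ⊔ ℓ₁ ⊔ ℓ)
  L X w = ∀ u → X u → w N u

  γ : ∀ {ℓ} → Pred W ℓ → Pred W (c ⊔ ℓ₁ ⊔ ℓ)
  γ X = L (U X)

  -- X ∈ A⁺  iff  X = L(U(X))  (as sets: mutual inclusion)
  Closed : Sub → Set (c ⊔ ℓ₁)
  Closed X = (X ⊆ γ X) × (γ X ⊆ X)

  -- Operations of the complete lattice (A⁺, ⊆):
  -- top = W, bottom = γ ∅, join = γ (X ∪ Y), meet = X ∩ Y,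
  -- implication X → Y = ⋁ { Z ∈ A⁺ : Z ∩ X ⊆ Y } = γ (⋃ {Z ∈ A⁺ : Z ∩ X ⊆ Y}).
  ⊤⁺ : Pred W c
  ⊤⁺ _ = Level.Lift c Data.Unit.⊤
    where import Data.Unit

  ⊥⁺ : Pred W (c ⊔ ℓ₁)
  ⊥⁺ = γ (λ (_ : W) → ⊥ {c ⊔ ℓ₁})

  _∨⁺_ : ∀ {ℓ ℓ'} → Pred W ℓ → Pred W ℓ' → Pred W (c ⊔ ℓ₁ ⊔ ℓ ⊔ ℓ')
  X ∨⁺ Y = γ (X ∪ Y)

  _⇒⁺_ : ∀ {ℓ ℓ'} → Pred W ℓ → Pred W ℓ' → Pred W (suc (c ⊔ ℓ₁) ⊔ ℓ ⊔ ℓ')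
  X ⇒⁺ Y = γ (λ w → Σ Sub (λ Z → Closed Z × ((Z ∩ X) ⊆ Y) × Z w))

  _*⁺ : ∀ {ℓ} → Pred W ℓ → Pred W (suc (c ⊔ ℓ₁) ⊔ ℓ)
  X *⁺ = X ⇒⁺ ⊥⁺

  -- A⁺ ∈ BD₂ :  1 = X₂ ∨ (X₂ → (X₁ ∨ X₁*)) for all X₁ X₂ ∈ A⁺
  -- (the inclusion ⊇ into W is trivial, so the equation is W ⊆ RHS)
  BD₂⁺ : Set (suc (c ⊔ ℓ₁))
  BD₂⁺ = ∀ (X₁ X₂ : Sub) → Closed X₁ → Closed X₂ →
         ⊤⁺ ⊆ (X₂ ∨⁺ (X₂ ⇒⁺ (X₁ ∨⁺ (X₁ *⁺))))

module Submission where

-- Fix w = (s , a) and an upper bound u = (t , b) of X₂ ∪ (X₂ ⇒⁺ (X₁ ∨⁺ X₁*⁺)); we must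
-- show w N u.  With c = t ∨ b, once (c , 1) N u holds, every point is N-related to u
-- (lemma absorbing), so it suffices to place (c , 1) in X₂ ⇒⁺ (X₁ ∨⁺ X₁*⁺).  The witness
-- is the closed set Z = L (E c), where E c consists of the points (0 , c → (x ∨ x*));
-- the BD₂ equation says precisely that (c , 1) ∈ Z.  For Z ∩ X₂ ⊆ X₁ ∨⁺ X₁*⁺: a point
-- (s , a) of Z ∩ X₂ satisfies s ∨ (a → (x ∨ x*)) = 1 for every x, and for any upper
-- bound (r , d) of X₁ ∪ X₁*⁺ the point (s ∨ r , a ∧ d*) lies in X₁*⁺ (again via a
-- closed set of the form L T); excluded middle at d then yields (s , a) N (r , d).

open import Defs
open import Level using (Level; _⊔_)
open import Relation.Binary.Lattice.Bundles using (HeytingAlgebra)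
open import Data.Product using (_×_; _,_; Σ)
open import Data.Sum using (inj₁; inj₂)
open import Relation.Unary using (Pred; _⊆_; _∩_; _∪_)
open import Relation.Binary.PropositionalEquality using (_≡_; refl)

module HeytingFacts {c ℓ₁ ℓ₂ : Level} (A : HeytingAlgebra c ℓ₁ ℓ₂) where
  open HeytingAlgebra A renaming (⊤ to 1A; ⊥ to 0A; refl to ≤-refl)
  open HyperMacNeille A using (_*; _N_)
  open import Relation.Binary.Lattice.Properties.HeytingAlgebra A
    using (⇨-eval; y≤x⇨y; ⇨ʳ-covariant; ⇨-relax; ⇨-curry; ∧-distribˡ-∨-≤; ⇨-distribˡ-∧-≥)
  open import Relation.Binary.Lattice.Properties.MeetSemilattice meetSemilattice
    using (∧-monotonic; ∧-comm)
  open import Relation.Binary.Lattice.Properties.JoinSemilattice joinSemilattice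
    using (∨-monotonic; ∨-assoc)
  open import Relation.Binary.Reasoning.PartialOrder poset

  ≈1-mono : ∀ {x y} → x ≤ y → x ≈ 1A → y ≈ 1A
  ≈1-mono x≤y x≈1 = antisym (maximum _) (trans (reflexive (Eq.sym x≈1)) x≤y)

  ≈1-combine : ∀ {s p q r} → s ∨ p ≈ 1A → s ∨ q ≈ 1A → p ∧ q ≤ r → s ∨ r ≈ 1A
  ≈1-combine {s} {p} {q} {r} s∨p≈1 s∨q≈1 p∧q≤r =
    ≈1-mono distribute (antisym (maximum _) (∧-greatest (reflexive (Eq.sym s∨p≈1))
                                                         (reflexive (Eq.sym s∨q≈1))))
    where
      distribute : (s ∨ p) ∧ (s ∨ q) ≤ s ∨ r
      distribute = begin
        (s ∨ p) ∧ (s ∨ q)         ≤⟨ ∧-distribˡ-∨-≤ _ _ _ ⟩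
        (s ∨ p) ∧ s ∨ (s ∨ p) ∧ q ≤⟨ ∨-monotonic (x∧y≤y _ _) (reflexive (∧-comm _ _)) ⟩
        s ∨ q ∧ (s ∨ p)           ≤⟨ ∨-monotonic ≤-refl (∧-distribˡ-∨-≤ _ _ _) ⟩
        s ∨ (q ∧ s ∨ q ∧ p)       ≤⟨ ∨-least (x≤x∨y _ _) (∨-least
                                       (trans (x∧y≤y _ _) (x≤x∨y _ _))
                                       (trans (reflexive (∧-comm _ _))
                                              (trans p∧q≤r (y≤x∨y _ _)))) ⟩
        s ∨ r                     ∎

  ⇨-combine : ∀ {a p q r} → p ∧ q ≤ r → (a ⇨ p) ∧ (a ⇨ q) ≤ a ⇨ r
  ⇨-combine p∧q≤r = trans (⇨-distribˡ-∧-≥ _ _ _) (⇨ʳ-covariant p∧q≤r)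

  ⇨-∨-elim : ∀ {x d} → (x ⇨ d) ∧ (d ∨ x) ≤ d
  ⇨-∨-elim = trans (∧-distribˡ-∨-≤ _ _ _) (∨-least (x∧y≤y _ _) ⇨-eval)

  contrapose : ∀ {x y} → x ⇨ y ≤ y * ⇨ x *
  contrapose = transpose-⇨ (transpose-⇨ (trans (∧-greatest
    (trans (x∧y≤x _ _) (x∧y≤y _ _)) (trans (∧-monotonic (x∧y≤x _ _) ≤-refl) ⇨-eval)) ⇨-eval))

  self-refuting : ∀ {a b} → a ⇨ a * ≤ a ⇨ b
  self-refuting = transpose-⇨ (trans (∧-greatest ⇨-eval (x∧y≤y _ _)) (trans ⇨-eval (minimum _)))

  absorbing : ∀ {t b} → (t ∨ b , 1A) N (t , b) → ∀ w → w N (t , b)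
  absorbing {t} {b} h (s , a) = ≈1-mono (trans collapse spread) h
    where
      collapse : (t ∨ b) ∨ t ∨ (1A ⇨ b) ≤ t ∨ b
      collapse = ∨-least ≤-refl (∨-least (x≤x∨y _ _)
                   (trans (trans (∧-greatest ≤-refl (maximum _)) ⇨-eval) (y≤x∨y _ _)))
      spread : t ∨ b ≤ s ∨ t ∨ (a ⇨ b)
      spread = ∨-least (trans (x≤x∨y _ _) (y≤x∨y _ _))
                       (trans y≤x⇨y (trans (y≤x∨y _ _) (y≤x∨y _ _)))

  bd₂-point : ∀ {k y} → k ∨ (k ⇨ y) ≈ 1A → (k , 1A) N (0A , k ⇨ y)
  bd₂-point = ≈1-mono (∨-monotonic ≤-refl (trans y≤x⇨y (y≤x∨y _ _)))

  detach : ∀ {s a t b y} → (s , a) N (t , b) → (s , a) N (0A , (t ∨ b) ⇨ y) →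
           s ∨ (a ⇨ y) ≈ 1A
  detach h₁ h₂ = ≈1-combine h₁ h₂
    (trans (∧-monotonic premise (∨-least (minimum _) ≤-refl))
           (⇨-combine (trans (reflexive (∧-comm _ _)) ⇨-eval)))
    where
      premise : ∀ {t a b} → t ∨ (a ⇨ b) ≤ a ⇨ (t ∨ b)
      premise = ∨-least (trans (x≤x∨y _ _) y≤x⇨y) (⇨ʳ-covariant (y≤x∨y _ _))

  contrapose-N : ∀ {σ α r d s a} → (σ , α) N (r , d) → (s ∨ r , a ∧ d *) N (σ , α *)
  contrapose-N = ≈1-mono (∨-least (trans (x≤x∨y _ _) (y≤x∨y _ _))
    (∨-least (trans (y≤x∨y _ _) (x≤x∨y _ _))
             (trans (trans contrapose (⇨-relax (x∧y≤y _ _) ≤-refl))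
                    (trans (y≤x∨y _ _) (y≤x∨y _ _)))))

  self-refuting-N : ∀ {s a} → (s , a) N (s , a *) → ∀ u → (s , a) N u
  self-refuting-N h (t , b) = ≈1-mono (∨-least (x≤x∨y _ _)
    (∨-least (x≤x∨y _ _) (trans self-refuting (trans (y≤x∨y _ _) (y≤x∨y _ _))))) h

  excluded-middle-N : ∀ {s a r d} → (s ∨ r , a ∧ d *) N (r , d) →
                      s ∨ (a ⇨ (d ∨ d *)) ≈ 1A → (s , a) N (r , d)
  excluded-middle-N {s} {a} {r} {d} h₁ h₂ =
    ≈1-mono (reflexive (∨-assoc s r _)) (≈1-combine h₁′ h₂′
      (trans (∧-monotonic (reflexive ⇨-curry) ≤-refl) (⇨-combine ⇨-∨-elim)))
    where
      h₁′ : (s ∨ r) ∨ ((a ∧ d *) ⇨ d) ≈ 1A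
      h₁′ = ≈1-mono (∨-least (x≤x∨y _ _)
              (∨-least (trans (y≤x∨y s r) (x≤x∨y _ _)) (y≤x∨y _ _))) h₁
      h₂′ : (s ∨ r) ∨ (a ⇨ (d ∨ d *)) ≈ 1A
      h₂′ = ≈1-mono (∨-monotonic (x≤x∨y _ _) ≤-refl) h₂

module GaloisFacts {c ℓ₁ ℓ₂ : Level} (A : HeytingAlgebra c ℓ₁ ℓ₂) where
  open HyperMacNeille A

  γ-extensive : ∀ {ℓ} {X : Pred W ℓ} → X ⊆ γ X
  γ-extensive {x = w} w∈X u u∈UX = u∈UX w w∈X

  -- Every set of the form L T is Galois-closed (for small T this is Closed (L T)).
  L-closed : ∀ {ℓ} (T : Pred W ℓ) → (L T ⊆ γ (L T)) × (γ (L T) ⊆ L T)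
  L-closed T = γ-extensive , λ g u t → g u (λ w lw → lw u t)

  ⇒⁺-intro : ∀ {ℓ ℓ′} {X : Pred W ℓ} {Y : Pred W ℓ′} {Z : Sub} →
             Closed Z → (Z ∩ X) ⊆ Y → Z ⊆ (X ⇒⁺ Y)
  ⇒⁺-intro {Z = Z} closed Z∩X⊆Y z = γ-extensive (Z , closed , (λ {v} → Z∩X⊆Y {v}) , z)

  -- A point N-related to every point belongs to the bottom ⊥⁺ = L (U ∅) = L W.
  ⊥⁺-intro : ∀ {w} → (∀ u → w N u) → ⊥⁺ w
  ⊥⁺-intro w-N u _ = w-N u

module Completion {c ℓ₁ ℓ₂ : Level} (A : HeytingAlgebra c ℓ₁ ℓ₂) where
  open HeytingAlgebra A using (Carrier; _≈_; _∨_; _∧_; _⇨_) renaming (⊤ to 1A; ⊥ to 0A)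
  open HyperMacNeille A
  open HeytingFacts A
  open GaloisFacts A

  excluded-middle-points : Carrier → Pred W c
  excluded-middle-points k u = Σ Carrier λ x → u ≡ (0A , k ⇨ (x ∨ x *))

  -- An upper bound (r , d) of X ∪ X*⁺ is N-above every (s , a) with
  -- s ∨ (a ⇨ (d ∨ d*)) = 1, because (s ∨ r , a ∧ d*) belongs to X*⁺.
  pseudo-complement-bound : (X : Sub) {r d : Carrier} → U (X ∪ (X *⁺)) (r , d) →
                            ∀ {s a} → s ∨ (a ⇨ (d ∨ d *)) ≈ 1A → (s , a) N (r , d)
  pseudo-complement-bound X {r} {d} bound {s} {a} =
    excluded-middle-N (bound (s ∨ r , a ∧ d *)
      (inj₂ (⇒⁺-intro (L-closed T) (λ {w} → refuted {w}) contraposed)))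
    where
      T : Pred W (c ⊔ ℓ₁)
      T u = Σ Carrier λ σ → Σ Carrier λ α → ((σ , α) N (r , d)) × (u ≡ (σ , α *))
      contraposed : L T (s ∨ r , a ∧ d *)
      contraposed _ (σ , α , σα-N , refl) = contrapose-N σα-N
      refuted : (L T ∩ X) ⊆ ⊥⁺
      refuted {σ , α} (in-LT , x) =
        ⊥⁺-intro (self-refuting-N (in-LT _ (σ , α , bound (σ , α) (inj₁ x) , refl)))

  excluded-middle-meets : (X₁ X₂ : Sub) {t b : Carrier} → U X₂ (t , b) →
    (L (excluded-middle-points (t ∨ b)) ∩ X₂) ⊆ (X₁ ∨⁺ (X₁ *⁺))
  excluded-middle-meets X₁ X₂ above {s , a} (z , x₂) (r , d) bound =
    pseudo-complement-bound X₁ bound (detach (above (s , a) x₂) (z _ (d , refl)))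

proposition7p10 : ∀ {c ℓ₁ ℓ₂ : Level} (A : HeytingAlgebra c ℓ₁ ℓ₂) →
    HyperMacNeille.BD₂ A → HyperMacNeille.BD₂⁺ A
proposition7p10 A bd X₁ X₂ _ _ {w} _ (t , b) upper =
  absorbing (upper (t ∨ b , 1A) (inj₂ top-in-implication)) w
  where
    open HeytingAlgebra A using (_∨_; module Eq) renaming (⊤ to 1A)
    open HyperMacNeille A
    open HeytingFacts A
    open GaloisFacts A
    open Completion A

    top-in-Z : L (excluded-middle-points (t ∨ b)) (t ∨ b , 1A)
    top-in-Z _ (x , refl) = bd₂-point (Eq.sym (bd x (t ∨ b)))

    top-in-implication : (X₂ ⇒⁺ (X₁ ∨⁺ (X₁ *⁺))) (t ∨ b , 1A)
    top-in-implication = ⇒⁺-intro (L-closed (excluded-middle-points (t ∨ b)))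
      (λ {v} → excluded-middle-meets X₁ X₂ (λ v x₂ → upper v (inj₁ x₂)) {v}) top-in-Z
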